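{- Let $a: M_{2,2,2}(\{ -3,0\},\{ -1,2\})\to\mathbb{Z}_{\ge 0}$ be a function and let $X\in\{\mathrm{I},\mathrm{II}\}$. If $Q(B(X,2);a)$ is positive semidefinite and $\sum_{A} a(A)=9$, then $a(A)=0$ for every $A\notin\mathcal{M}_X$.
   Context: For sets of numbers $Z,Y$, $M_{2,2,2}(Z,Y)$ denotes the set of $2\times 4$ real matrices whose first two columns have entries in $Z$ and whose last two columns have entries in $Y$. For a finite set $\mathcal{N}$ of $2\times r$ matrices, a function $a:\mathcal{N}\to\mathbb{Z}_{\ge 0}$ and an $r\times r$ matrix $Q_{11}$, let $Q_{21}$ be the matrix obtained by stacking vertically $a(A)$ copies of each $A\in\mathcal{N}$, let $m=\sum_{A}a(A)$, let $Q_{22}=\begin{bmatrix}6&-3\\-3&6\end{bmatrix}^{\oplus m}$ (block diagonal), and put $Q(Q_{11};a)=\begin{bmatrix}Q_{11}&Q_{21}^\top\\ Q_{21}&Q_{22}\end{bmatrix}$. Define $B^{(\mathrm{I})}_{11}=\begin{bmatrix}4&-2\\-2&4\end{bmatrix}$, $B^{(\mathrm{II})}_{11}=\begin{bmatrix}4&-1\\-1&4\end{bmatrix}$, $B_{22}=\begin{bmatrix}6&-3\\-3&6\end{bmatrix}$, $B^{(2)}_{21}=\begin{bmatrix}-2&1\\1&1\end{bmatrix}$ and $B(X,2)=\begin{bmatrix}B^{(X)}_{11}&B^{(2)\top}_{21}\\ B^{(2)}_{21}&B_{22}\end{bmatrix}$. For a $2\times t$ matrix $A$, $\bar A$ denotes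 the matrix obtained from $A$ by exchanging its two rows. Let $\mathcal{M}'_{\mathrm{I}}$ be the set of the five matrices $\begin{bmatrix}0&0&-1&-1\\0&0&-1&2\end{bmatrix}$, $\begin{bmatrix}0&0&-1&-1\\0&0&2&-1\end{bmatrix}$, $\begin{bmatrix}0&0&-1&2\\0&0&2&-1\end{bmatrix}$, $\begin{bmatrix}-3&0&2&-1\\0&0&-1&-1\end{bmatrix}$, $\begin{bmatrix}0&-3&-1&-1\\0&0&2&-1\end{bmatrix}$, and let $\mathcal{M}'_{\mathrm{II}}$ be the union of $\mathcal{M}'_{\mathrm{I}}$ with the three matrices $\begin{bmatrix}-3&0&2&-1\\0&0&-1&2\end{bmatrix}$, $\begin{bmatrix}0&-3&-1&-1\\0&0&-1&2\end{bmatrix}$, $\begin{bmatrix}-3&0&2&-1\\0&-3&-1&-1\end{bmatrix}$. For $X\in\{\mathrm{I},\mathrm{II}\}$ let $\mathcal{M}_X=\mathcal{M}'_X\cup\{\bar A: A\in\mathcal{M}'_X\}$. -}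

module Defs where

open import Data.Bool using (Bool; true; false; T; _∧_; if_then_else_)
open import Data.Nat as ℕ using (ℕ; zero; suc)
open import Data.Integer as ℤ using (ℤ; +_; -[1+_])
open import Data.Rational as ℚ using (ℚ; 0ℚ)
open import Data.Fin using (Fin; zero; suc; splitAt; remQuot)
open import Data.Fin.Properties using () renaming (_≟_ to _≟ᶠ_)
open import Data.Vec as Vec using (Vec; []; _∷_; lookup)
open import Data.List as List using (List; []; _∷_; _++_; concatMap; replicate; mapMaybe; length)
open import Data.Bool.ListAction using (any)
open import Data.Nat.ListAction using (sum)
open import Data.Maybe using (Maybe; just; nothing)
open import Data.Product using (Σ; _,_; proj₁; proj₂; _×_)
open import Data.Sum using (inj₁; inj₂)
open import Relation.Nullary using (yes; no)
open import Relation.Nullary.Decidable using (⌊_⌋)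
open import Data.Bool.Properties using (T?)

SqMat : ℕ → Set
SqMat n = Fin n → Fin n → ℤ

Mat24 : Set
Mat24 = Vec (Vec ℤ 4) 2

ΣFin : (n : ℕ) → (Fin n → ℚ) → ℚ
ΣFin zero    f = 0ℚ
ΣFin (suc n) f = f zero ℚ.+ ΣFin n (λ i → f (suc i))

ℤ→ℚ : ℤ → ℚ
ℤ→ℚ z = z ℚ./ 1

PSD : (n : ℕ) → SqMat n → Set
PSD n Q = (x : Fin n → ℚ) →
  0ℚ ℚ.≤ ΣFin n (λ i → ΣFin n (λ j → x i ℚ.* ℤ→ℚ (Q i j) ℚ.* x j))

_==ℤ_ : ℤ → ℤ → Bool
(+ m)    ==ℤ (+ n)    = m ℕ.≡ᵇ n
-[1+ m ] ==ℤ -[1+ n ] = m ℕ.≡ᵇ n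
_        ==ℤ _        = false

_∈ᵇ_ : ℤ → List ℤ → Bool
x ∈ᵇ S = any (λ z → x ==ℤ z) S

inM222ᵇ : List ℤ → List ℤ → Mat24 → Bool
inM222ᵇ Z Y ((a ∷ b ∷ c ∷ d ∷ []) ∷ (e ∷ f ∷ g ∷ h ∷ []) ∷ []) =
  (a ∈ᵇ Z) ∧ (b ∈ᵇ Z) ∧ (c ∈ᵇ Y) ∧ (d ∈ᵇ Y) ∧
  (e ∈ᵇ Z) ∧ (f ∈ᵇ Z) ∧ (g ∈ᵇ Y) ∧ (h ∈ᵇ Y)

-- elements of M_{2,2,2}(Z,Y): a 2×4 matrix together with the
-- (proof-irrelevant, since T b is ⊤ or ⊥) evidence of membership
M222 : List ℤ → List ℤ → Set
M222 Z Y = Σ Mat24 (λ A → T (inM222ᵇ Z Y A))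

candidates : List ℤ → List ℤ → List Mat24
candidates Z Y =
  concatMap (λ a → concatMap (λ b → concatMap (λ c → concatMap (λ d →
  concatMap (λ e → concatMap (λ f → concatMap (λ g → List.map (λ h →
    (a ∷ b ∷ c ∷ d ∷ []) ∷ (e ∷ f ∷ g ∷ h ∷ []) ∷ [])
  Y) Y) Z) Z) Y) Y) Z) Z

check : (Z Y : List ℤ) → Mat24 → Maybe (M222 Z Y)
check Z Y A with T? (inM222ᵇ Z Y A)
... | yes p = just (A , p)
... | no  _ = nothing

allM222 : (Z Y : List ℤ) → List (M222 Z Y)
allM222 Z Y = mapMaybe (check Z Y) (candidates Z Y)

Z₀ Y₀ : List ℤ
Z₀ = ℤ.- (+ 3) ∷ + 0 ∷ []
Y₀ = ℤ.- (+ 1) ∷ + 2 ∷ []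

M : Set
M = M222 Z₀ Y₀

allM : List M
allM = allM222 Z₀ Y₀

total : (M → ℕ) → ℕ
total a = sum (List.map a allM)

-- the list N of 2×4 matrices, each A repeated a(A) times (this is Q₂₁,
-- stacked vertically)
stack : (M → ℕ) → List Mat24
stack a = concatMap (λ A → replicate (a A) (proj₁ A)) allM

B22 : Vec (Vec ℤ 2) 2
B22 = (+ 6 ∷ ℤ.- (+ 3) ∷ []) ∷ (ℤ.- (+ 3) ∷ + 6 ∷ []) ∷ []

-- Q(Q₁₁;a) is a square matrix of size 4 + 2m, m = number of stacked blocks.
-- Index i < 4: row of Q₁₁; otherwise (block k, row s) of Q₂₁ / Q₂₂.
Qmat : (Q₁₁ : SqMat 4) → (a : M → ℕ) → SqMat (4 ℕ.+ length (stack a) ℕ.* 2)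
Qmat Q₁₁ a i j with splitAt 4 i | splitAt 4 j
... | inj₁ p | inj₁ q = Q₁₁ p q
... | inj₂ k | inj₁ q = let (b , s) = remQuot 2 k in
                        lookup (lookup (lookup (Vec.fromList (stack a)) b) s) q
... | inj₁ p | inj₂ k = let (b , s) = remQuot 2 k in
                        lookup (lookup (lookup (Vec.fromList (stack a)) b) s) p
... | inj₂ k | inj₂ l with remQuot {length (stack a)} 2 k | remQuot {length (stack a)} 2 l
...   | (b , s) | (c , t) with b ≟ᶠ c
...     | yes _ = lookup (lookup B22 s) t
...     | no  _ = + 0

data Case : Set where
  I II : Case

-- B(X,2) = [[B₁₁^(X), B₂₁^(2)ᵀ], [B₂₁^(2), B₂₂]]
Bvec : Case → Vec (Vec ℤ 4) 4
Bvec I  = (+ 4 ∷ ℤ.- (+ 2) ∷ ℤ.- (+ 2) ∷ + 1 ∷ [])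
        ∷ (ℤ.- (+ 2) ∷ + 4 ∷ + 1 ∷ + 1 ∷ [])
        ∷ (ℤ.- (+ 2) ∷ + 1 ∷ + 6 ∷ ℤ.- (+ 3) ∷ [])
        ∷ (+ 1 ∷ + 1 ∷ ℤ.- (+ 3) ∷ + 6 ∷ [])
        ∷ []
Bvec II = (+ 4 ∷ ℤ.- (+ 1) ∷ ℤ.- (+ 2) ∷ + 1 ∷ [])
        ∷ (ℤ.- (+ 1) ∷ + 4 ∷ + 1 ∷ + 1 ∷ [])
        ∷ (ℤ.- (+ 2) ∷ + 1 ∷ + 6 ∷ ℤ.- (+ 3) ∷ [])
        ∷ (+ 1 ∷ + 1 ∷ ℤ.- (+ 3) ∷ + 6 ∷ [])
        ∷ []

B : Case → SqMat 4
B X p q = lookup (lookup (Bvec X) p) q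

mk : ℤ → ℤ → ℤ → ℤ → ℤ → ℤ → ℤ → ℤ → Mat24
mk a b c d e f g h = (a ∷ b ∷ c ∷ d ∷ []) ∷ (e ∷ f ∷ g ∷ h ∷ []) ∷ []

bar : Mat24 → Mat24
bar (r ∷ s ∷ []) = s ∷ r ∷ []

private
  m3 m1 z t : ℤ
  m3 = ℤ.- (+ 3)
  m1 = ℤ.- (+ 1)
  z  = + 0
  t  = + 2

M'I : List Mat24
M'I = mk z z m1 m1  z z m1 t
    ∷ mk z z m1 m1  z z t m1
    ∷ mk z z m1 t   z z t m1
    ∷ mk m3 z t m1  z z m1 m1
    ∷ mk z m3 m1 m1 z z t m1
    ∷ []

M' : Case → List Mat24
M' I  = M'I
M' II = M'I ++ ( mk m3 z t m1  z z m1 t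
               ∷ mk z m3 m1 m1 z z m1 t
               ∷ mk m3 z t m1  z m3 m1 m1
               ∷ [])

MX : Case → List Mat24
MX X = M' X ++ List.map bar (M' X)

-- If Q = Q(B;a) is positive semidefinite, so is its Schur complement B − Σ_b A_bᵀ B₂₂⁻¹ A_b, where
-- A₁, …, A_m (m = Σ a = 9) are the stacked blocks. Concretely, evaluating the quadratic form of Q at the
-- integral vector (9y ; −9 B₂₂⁻¹ A_b y)_b gives −9 Σ_b gap(A_b), where
-- gap(A) = 9 (Ay)ᵀ B₂₂⁻¹ (Ay) − yᵀ B y; hence Σ_b gap(A_b) ≤ 0 for every y. For each X a handful of
-- test vectors y is checked by evaluation: every A ∈ M_{2,2,2}({−3,0},{−1,2}) has gap(A) ≥ 0 for all of
-- them, and every A ∉ M_X has gap(A) > 0 for one of them. Such an A therefore cannot occur among the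
-- blocks, i.e. a(A) = 0.
module Submission where

open import Defs
open import Data.Bool using (Bool; true; false; T; _∧_; if_then_else_)
open import Data.Bool.Properties using (T-∧; T?; T-irrelevant)
open import Data.Nat as ℕ using (ℕ; zero; suc)
open import Data.Nat.Properties using (≡ᵇ⇒≡)
open import Data.Nat.ListAction using () renaming (sum to sumℕ)
open import Data.Integer as ℤ using (ℤ; +_; -[1+_]; 0ℤ; 1ℤ; -1ℤ; _+_; _*_; -_; _-_; _≤_; _<_; _≤?_; _<?_)
import Data.Integer.Properties as ℤ
open import Data.Integer.Tactic.RingSolver using (solve-∀)
open import Data.Rational as ℚ using (toℚᵘ)
open import Data.Rational.Properties using (toℚᵘ-fromℚᵘ; toℚᵘ-homo-+; toℚᵘ-homo-*; toℚᵘ-mono-≤)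
open import Data.Rational.Unnormalised as ℚᵘ using (ℚᵘ; mkℚᵘ; _≃_; *≡*; *≤*)
import Data.Rational.Unnormalised.Properties as ℚᵘ
open import Data.Fin using (Fin; zero; suc; _↑ˡ_; _↑ʳ_; combine; remQuot; quotRem; punchIn)
open import Data.Fin.Patterns using (0F; 1F; 2F; 3F)
open import Data.Fin.Properties using (remQuot-combine) renaming (_≟_ to _≟ᶠ_)
open import Data.Vec as Vec using (Vec; []; _∷_)
open import Data.Vec.Properties using (≡-dec)
open import Data.Vec.Functional using (Vector; map; _++_; concat; removeAt; fromVec)
open import Data.Vec.Functional.Properties using (lookup-++ˡ; lookup-++ʳ)
open import Data.Vec.Membership.Propositional.Properties using (∈-lookup; ∈-fromList⁺; ∈-fromList⁻)
import Data.Vec.Relation.Unary.Any as VecAny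
open import Data.Vec.Relation.Unary.Any.Properties using (lookup-index)
open import Data.List as List using (List; []; _∷_; length; replicate; concatMap)
open import Data.List.Properties using (length-++; length-replicate)
open import Data.List.Relation.Unary.All as All using (All; all?; lookupAny)
open import Data.List.Relation.Unary.All.Properties using (concat⁺; map⁺; replicate⁺)
open import Data.List.Relation.Unary.Any as Any using (Any; any?; here)
open import Data.List.Relation.Unary.Any.Properties using (any⁻; mapMaybe⁺) renaming (map⁺ to Any-map⁺)
open import Data.List.Membership.Propositional using (_∈_)
open import Data.List.Membership.Propositional.Properties using (∈-concatMap⁺; ∈-map⁺)
import Data.List.Membership.DecPropositional as DecMembership
open import Data.Maybe using (just)
import Data.Maybe.Relation.Unary.Any as Maybe
open import Data.Product using (_,_; _×_; proj₁; proj₂; ∃)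
open import Data.Sum using (_⊎_; [_,_]′)
open import Data.Empty using (⊥-elim)
open import Function using (_∘_; id; Equivalence)
open import Relation.Nullary using (¬_; Dec; does; yes; no)
open import Relation.Nullary.Decidable using (toWitness; _⊎-dec_; decidable-stable)
open import Relation.Binary.PropositionalEquality
  using (_≡_; _≢_; refl; sym; trans; cong; cong₂; subst; subst₂; module ≡-Reasoning)
open import Algebra.Properties.CommutativeMonoid.Sum ℤ.+-0-commutativeMonoid
  using (sum; sum-syntax; sum-cong-≗; sum-replicate-zero; sum-remove; ∑-distrib-+; ∑-comm)
open import Algebra.Properties.Semiring.Sum ℤ.+-*-semiring using (*-distribˡ-sum)

∑-↑ : ∀ m n (f : Fin (m ℕ.+ n) → ℤ) →
      sum f ≡ ∑[ i < m ] f (i ↑ˡ n) + ∑[ j < n ] f (m ↑ʳ j)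
∑-↑ zero    n f = sym (ℤ.+-identityˡ _)
∑-↑ (suc m) n f = trans (cong (_+_ (f zero)) (∑-↑ m n (f ∘ suc)))
  (sym (ℤ.+-assoc (f zero) (∑[ i < m ] f (suc i ↑ˡ n)) (∑[ j < n ] f (suc m ↑ʳ j))))

∑-combine : ∀ m k (f : Fin (m ℕ.* k) → ℤ) →
            sum f ≡ ∑[ b < m ] ∑[ s < k ] f (combine b s)
∑-combine zero    k f = refl
∑-combine (suc m) k f =
  trans (∑-↑ k (m ℕ.* k) f) (cong (_+_ (∑[ s < k ] f (s ↑ˡ m ℕ.* k))) (∑-combine m k (f ∘ (k ↑ʳ_))))

∑-bordered : ∀ r m k (f : Fin (r ℕ.+ m ℕ.* k) → ℤ) →
             sum f ≡ ∑[ p < r ] f (p ↑ˡ m ℕ.* k) + ∑[ b < m ] ∑[ s < k ] f (r ↑ʳ combine b s)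
∑-bordered r m k f =
  trans (∑-↑ r (m ℕ.* k) f) (cong (_+_ (∑[ p < r ] f (p ↑ˡ m ℕ.* k))) (∑-combine m k (f ∘ (r ↑ʳ_))))

∑-δ : ∀ {m} (b : Fin m) (g : Fin m → ℤ) →
      ∑[ c < m ] (if does (b ≟ᶠ c) then g c else 0ℤ) ≡ g b
∑-δ {suc m} zero    g = trans (cong (_+_ (g zero)) (sum-replicate-zero m)) (ℤ.+-identityʳ _)
∑-δ {suc m} (suc b) g = trans (ℤ.+-identityˡ _) (∑-δ b (g ∘ suc))

∑-if : ∀ {n} (d : Bool) (f : Vector ℤ n) →
       ∑[ i < n ] (if d then f i else 0ℤ) ≡ (if d then sum f else 0ℤ)
∑-if {n} true  f = refl
∑-if {n} false f = sum-replicate-zero n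

*-if : ∀ (d : Bool) x y z → x * (if d then y else 0ℤ) * z ≡ (if d then x * y * z else 0ℤ)
*-if true  x y z = refl
*-if false x y z = trans (cong (_* z) (ℤ.*-zeroʳ x)) (ℤ.*-zeroˡ z)

∑-const : ∀ n c → ∑[ i < n ] c ≡ + n * c
∑-const zero    c = sym (ℤ.*-zeroˡ c)
∑-const (suc n) c = trans (cong (_+_ (c)) (∑-const n c)) (sym (ℤ.suc-* (+ n) c))

∑-nonneg : ∀ {n} {f : Vector ℤ n} → (∀ i → 0ℤ ≤ f i) → 0ℤ ≤ sum f
∑-nonneg {zero}  0≤f = ℤ.≤-refl
∑-nonneg {suc n} 0≤f = ℤ.+-mono-≤ (0≤f zero) (∑-nonneg (0≤f ∘ suc))

≤-∑ : ∀ {n} {f : Vector ℤ n} → (∀ i → 0ℤ ≤ f i) → ∀ i → f i ≤ sum f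
≤-∑ {suc n} {f} 0≤f i = begin
  f i                          ≡⟨ ℤ.+-identityʳ (f i) ⟨
  f i + 0ℤ                     ≤⟨ ℤ.+-monoʳ-≤ (f i) (∑-nonneg (0≤f ∘ punchIn i)) ⟩
  f i + sum (removeAt f i)     ≡⟨ sum-remove f ⟨
  sum f                        ∎
  where open ℤ.≤-Reasoning

∑₂ : ∀ (f : Vector ℤ 2) → sum f ≡ f 0F + f 1F
∑₂ f = cong (_+_ (f 0F)) (ℤ.+-identityʳ (f 1F))

_∙_ : ∀ {n} → Vector ℤ n → Vector ℤ n → ℤ
_∙_ {n} x y = ∑[ i < n ] (x i * y i)

_*ᵥ_ : ∀ {m n} → (Fin m → Fin n → ℤ) → Vector ℤ n → Vector ℤ m
_*ᵥ_ {n = n} M x i = ∑[ j < n ] (M i j * x j)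

bilinear : ∀ {m n} → (Fin m → Fin n → ℤ) → Vector ℤ m → Vector ℤ n → ℤ
bilinear {m} {n} M ξ x = ∑[ i < m ] ∑[ j < n ] (ξ i * M i j * x j)

quadForm : ∀ {n} → SqMat n → Vector ℤ n → ℤ
quadForm Q x = bilinear Q x x

bilinear≡∙*ᵥ : ∀ {m n} (M : Fin m → Fin n → ℤ) ξ x → bilinear M ξ x ≡ ξ ∙ (M *ᵥ x)
bilinear≡∙*ᵥ M ξ x = sum-cong-≗ λ i →
  trans (sum-cong-≗ λ j → ℤ.*-assoc (ξ i) (M i j) (x j)) (sym (*-distribˡ-sum (ξ i) λ j → M i j * x j))

bilinear-transpose : ∀ {m n} (M : Fin m → Fin n → ℤ) ξ x →
                     ∑[ j < n ] ∑[ i < m ] (x j * M i j * ξ i) ≡ bilinear M ξ x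
bilinear-transpose M ξ x = trans (∑-comm λ j i → x j * M i j * ξ i)
  (sum-cong-≗ λ i → sum-cong-≗ λ j → reverse (x j) (M i j) (ξ i))
  where
  reverse : ∀ u v w → u * v * w ≡ w * v * u
  reverse = solve-∀

bilinear-scaleˡ : ∀ {m n} (M : Fin m → Fin n → ℤ) k ξ x →
                  bilinear M (map (k *_) ξ) x ≡ k * bilinear M ξ x
bilinear-scaleˡ M k ξ x = trans
  (sum-cong-≗ λ i → trans (sum-cong-≗ λ j → pull k (ξ i) (M i j) (x j))
                             (sym (*-distribˡ-sum k λ j → ξ i * M i j * x j)))
  (sym (*-distribˡ-sum k λ i → ∑[ j < _ ] (ξ i * M i j * x j)))
  where
  pull : ∀ k u v w → k * u * v * w ≡ k * (u * v * w)
  pull = solve-∀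

bilinear-scaleʳ : ∀ {m n} (M : Fin m → Fin n → ℤ) k ξ x →
                  bilinear M ξ (map (k *_) x) ≡ k * bilinear M ξ x
bilinear-scaleʳ M k ξ x = trans
  (sum-cong-≗ λ i → trans (sum-cong-≗ λ j → pull k (ξ i) (M i j) (x j))
                             (sym (*-distribˡ-sum k λ j → ξ i * M i j * x j)))
  (sym (*-distribˡ-sum k λ i → ∑[ j < _ ] (ξ i * M i j * x j)))
  where
  pull : ∀ k u v w → u * v * (k * w) ≡ k * (u * v * w)
  pull = solve-∀

quadForm-scale : ∀ {n} (Q : SqMat n) k x → quadForm Q (map (k *_) x) ≡ k * k * quadForm Q x
quadForm-scale Q k x = begin
  bilinear Q (map (k *_) x) (map (k *_) x) ≡⟨ bilinear-scaleˡ Q k x _ ⟩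
  k * bilinear Q x (map (k *_) x)          ≡⟨ cong (k *_) (bilinear-scaleʳ Q k x x) ⟩
  k * (k * bilinear Q x x)                 ≡⟨ ℤ.*-assoc k k _ ⟨
  k * k * quadForm Q x                     ∎
  where open ≡-Reasoning

quadForm₂ : ∀ (Q : SqMat 2) x →
  quadForm Q x ≡ (x 0F * Q 0F 0F * x 0F + x 0F * Q 0F 1F * x 1F)
               + (x 1F * Q 1F 0F * x 0F + x 1F * Q 1F 1F * x 1F)
quadForm₂ Q x = trans (∑₂ λ i → ∑[ j < 2 ] (x i * Q i j * x j))
                      (cong₂ _+_ (∑₂ λ j → x 0F * Q 0F j * x j) (∑₂ λ j → x 1F * Q 1F j * x j))

-- Positive semidefiniteness over ℚ, tested on integer vectors

ℤ→ℚᵘ : ℤ → ℚᵘ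
ℤ→ℚᵘ z = mkℚᵘ z 0

ℤ→ℚᵘ-+ : ∀ a b → ℤ→ℚᵘ a ℚᵘ.+ ℤ→ℚᵘ b ≃ ℤ→ℚᵘ (a + b)
ℤ→ℚᵘ-+ a b = *≡* (cross-multiplied a b)
  where
  cross-multiplied : ∀ a b → (a * 1ℤ + b * 1ℤ) * 1ℤ ≡ (a + b) * (1ℤ * 1ℤ)
  cross-multiplied = solve-∀

ℤ→ℚᵘ-* : ∀ a b → ℤ→ℚᵘ a ℚᵘ.* ℤ→ℚᵘ b ≃ ℤ→ℚᵘ (a * b)
ℤ→ℚᵘ-* a b = *≡* (cross-multiplied a b)
  where
  cross-multiplied : ∀ a b → a * b * 1ℤ ≡ a * b * (1ℤ * 1ℤ)
  cross-multiplied = solve-∀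

ℤ→ℚᵘ-cancel-≤ : ∀ {a b} → ℤ→ℚᵘ a ℚᵘ.≤ ℤ→ℚᵘ b → a ≤ b
ℤ→ℚᵘ-cancel-≤ {a} {b} (*≤* a≤b) = subst₂ _≤_ (ℤ.*-identityʳ a) (ℤ.*-identityʳ b) a≤b

toℚᵘ-ℤ→ℚ : ∀ z → toℚᵘ (ℤ→ℚ z) ≃ ℤ→ℚᵘ z
toℚᵘ-ℤ→ℚ z = toℚᵘ-fromℚᵘ (ℤ→ℚᵘ z)

toℚᵘ-* : ∀ a b {p q} → toℚᵘ p ≃ ℤ→ℚᵘ a → toℚᵘ q ≃ ℤ→ℚᵘ b → toℚᵘ (p ℚ.* q) ≃ ℤ→ℚᵘ (a * b)
toℚᵘ-* a b {p} {q} p≃a q≃b =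
  ℚᵘ.≃-trans (toℚᵘ-homo-* p q) (ℚᵘ.≃-trans (ℚᵘ.*-cong p≃a q≃b) (ℤ→ℚᵘ-* a b))

toℚᵘ-ΣFin : ∀ n {g : Fin n → ℚ.ℚ} {f : Fin n → ℤ} →
            (∀ i → toℚᵘ (g i) ≃ ℤ→ℚᵘ (f i)) → toℚᵘ (ΣFin n g) ≃ ℤ→ℚᵘ (sum f)
toℚᵘ-ΣFin zero    g≃f = ℚᵘ.≃-refl
toℚᵘ-ΣFin (suc n) {g} {f} g≃f = ℚᵘ.≃-trans (toℚᵘ-homo-+ (g zero) (ΣFin n (g ∘ suc)))
  (ℚᵘ.≃-trans (ℚᵘ.+-cong (g≃f zero) (toℚᵘ-ΣFin n (g≃f ∘ suc))) (ℤ→ℚᵘ-+ (f zero) (sum (f ∘ suc))))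

PSD⇒0≤quadForm : ∀ {n} {Q : SqMat n} → PSD n Q → ∀ x → 0ℤ ≤ quadForm Q x
PSD⇒0≤quadForm {n} {Q} psd x =
  ℤ→ℚᵘ-cancel-≤ (ℚᵘ.≤-respʳ-≃ toℚᵘ-form (toℚᵘ-mono-≤ (psd (ℤ→ℚ ∘ x))))
  where
  term : ∀ i j → toℚᵘ (ℤ→ℚ (x i) ℚ.* ℤ→ℚ (Q i j) ℚ.* ℤ→ℚ (x j)) ≃ ℤ→ℚᵘ (x i * Q i j * x j)
  term i j = toℚᵘ-* (x i * Q i j) (x j)
    (toℚᵘ-* (x i) (Q i j) (toℚᵘ-ℤ→ℚ (x i)) (toℚᵘ-ℤ→ℚ (Q i j))) (toℚᵘ-ℤ→ℚ (x j))
  toℚᵘ-form : toℚᵘ (ΣFin n λ i → ΣFin n λ j → ℤ→ℚ (x i) ℚ.* ℤ→ℚ (Q i j) ℚ.* ℤ→ℚ (x j))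
              ≃ ℤ→ℚᵘ (quadForm Q x)
  toℚᵘ-form = toℚᵘ-ΣFin n (λ i → toℚᵘ-ΣFin n (term i))

concat-combine : ∀ {m k} (ξ : Fin m → Vector ℤ k) b s → concat ξ (combine b s) ≡ ξ b s
concat-combine ξ b s = cong (λ (b , s) → ξ b s) (remQuot-combine b s)

module _ {r m k} (Q : SqMat (r ℕ.+ m ℕ.* k)) (x : Vector ℤ r) (ξ : Fin m → Vector ℤ k) where
  private
    v : Vector ℤ (r ℕ.+ m ℕ.* k)
    v = x ++ concat ξ

    v-↑ˡ : ∀ p → v (p ↑ˡ m ℕ.* k) ≡ x p
    v-↑ˡ = lookup-++ˡ x (concat ξ)

    v-↑ʳ : ∀ b s → v (r ↑ʳ combine b s) ≡ ξ b s
    v-↑ʳ b s = trans (lookup-++ʳ x (concat ξ) (combine b s)) (concat-combine ξ b s)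

    row : ∀ i {z} → v i ≡ z → ∑[ j < _ ] (v i * Q i j * v j)
          ≡ ∑[ q < r ] (z * Q i (q ↑ˡ m ℕ.* k) * x q)
            + ∑[ c < m ] ∑[ t < k ] (z * Q i (r ↑ʳ combine c t) * ξ c t)
    row i refl = trans (∑-bordered r m k _) (cong₂ _+_
      (sum-cong-≗ λ q → cong (v i * Q i (q ↑ˡ m ℕ.* k) *_) (v-↑ˡ q))
      (sum-cong-≗ λ c → sum-cong-≗ λ t → cong (v i * Q i (r ↑ʳ combine c t) *_) (v-↑ʳ c t)))

  quadForm-bordered : quadForm Q (x ++ concat ξ) ≡
      (∑[ p < r ] ∑[ q < r ] (x p * Q (p ↑ˡ m ℕ.* k) (q ↑ˡ m ℕ.* k) * x q)
       + ∑[ p < r ] ∑[ c < m ] ∑[ t < k ] (x p * Q (p ↑ˡ m ℕ.* k) (r ↑ʳ combine c t) * ξ c t))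
    + (∑[ b < m ] ∑[ s < k ] ∑[ q < r ] (ξ b s * Q (r ↑ʳ combine b s) (q ↑ˡ m ℕ.* k) * x q)
       + ∑[ b < m ] ∑[ s < k ] ∑[ c < m ] ∑[ t < k ]
           (ξ b s * Q (r ↑ʳ combine b s) (r ↑ʳ combine c t) * ξ c t))
  quadForm-bordered = trans (∑-bordered r m k _) (cong₂ _+_
    (trans (sum-cong-≗ λ p → row (p ↑ˡ m ℕ.* k) (v-↑ˡ p)) (∑-distrib-+ T₁₁ T₁₂))
    (trans (sum-cong-≗ λ b → trans (sum-cong-≗ λ s → row (r ↑ʳ combine b s) (v-↑ʳ b s))
                                   (∑-distrib-+ (T₂₁ b) (T₂₂ b)))
           (∑-distrib-+ (sum ∘ T₂₁) (sum ∘ T₂₂))))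
    where
    T₁₁ T₁₂ : Fin r → ℤ
    T₁₁ p = ∑[ q < r ] (x p * Q (p ↑ˡ m ℕ.* k) (q ↑ˡ m ℕ.* k) * x q)
    T₁₂ p = ∑[ c < m ] ∑[ t < k ] (x p * Q (p ↑ˡ m ℕ.* k) (r ↑ʳ combine c t) * ξ c t)
    T₂₁ T₂₂ : Fin m → Fin k → ℤ
    T₂₁ b s = ∑[ q < r ] (ξ b s * Q (r ↑ʳ combine b s) (q ↑ˡ m ℕ.* k) * x q)
    T₂₂ b s = ∑[ c < m ] ∑[ t < k ] (ξ b s * Q (r ↑ʳ combine b s) (r ↑ʳ combine c t) * ξ c t)

entries : ∀ {r c} → Vec (Vec ℤ c) r → Fin r → Fin c → ℤ
entries A s q = Vec.lookup (Vec.lookup A s) q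

B₂₂ : SqMat 2
B₂₂ = entries B22

blocks : (a : M → ℕ) → Fin (length (stack a)) → Mat24
blocks a = Vec.lookup (Vec.fromList (stack a))

module _ (Q₁₁ : SqMat 4) (a : M → ℕ) where
  private
    m n : ℕ
    m = length (stack a)
    n = m ℕ.* 2

    A : Fin m → Fin 2 → Fin 4 → ℤ
    A = entries ∘ blocks a

    Q : SqMat (4 ℕ.+ n)
    Q = Qmat Q₁₁ a

  -- The Fin 4 index is split into its values so that splitAt 4 (p ↑ˡ n) computes; rewriting with
  -- splitAt-↑ˡ instead would normalise length (stack a), i.e. evaluate all of allM.
  Qmat-↑ˡ-↑ʳ : ∀ p c t → Q (p ↑ˡ n) (4 ↑ʳ combine c t) ≡ A c t p
  Qmat-↑ˡ-↑ʳ p@0F c t = cong (λ (c , t) → A c t p) (remQuot-combine c t)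
  Qmat-↑ˡ-↑ʳ p@1F c t = cong (λ (c , t) → A c t p) (remQuot-combine c t)
  Qmat-↑ˡ-↑ʳ p@2F c t = cong (λ (c , t) → A c t p) (remQuot-combine c t)
  Qmat-↑ˡ-↑ʳ p@3F c t = cong (λ (c , t) → A c t p) (remQuot-combine c t)

  Qmat-↑ʳ-↑ˡ : ∀ b s q → Q (4 ↑ʳ combine b s) (q ↑ˡ n) ≡ A b s q
  Qmat-↑ʳ-↑ˡ b s q@0F = cong (λ (b , s) → A b s q) (remQuot-combine b s)
  Qmat-↑ʳ-↑ˡ b s q@1F = cong (λ (b , s) → A b s q) (remQuot-combine b s)
  Qmat-↑ʳ-↑ˡ b s q@2F = cong (λ (b , s) → A b s q) (remQuot-combine b s)
  Qmat-↑ʳ-↑ˡ b s q@3F = cong (λ (b , s) → A b s q) (remQuot-combine b s)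

  Qmat-↑ʳ-↑ʳ : ∀ (b : Fin m) s c t →
               Q (4 ↑ʳ combine b s) (4 ↑ʳ combine c t) ≡ (if does (b ≟ᶠ c) then B₂₂ s t else 0ℤ)
  Qmat-↑ʳ-↑ʳ b s c t = trans (entry (combine b s) (combine c t))
                             (cong₂ blockDiagonal (remQuot-combine b s) (remQuot-combine c t))
    where
    blockDiagonal : Fin m × Fin 2 → Fin m × Fin 2 → ℤ
    blockDiagonal (b , s) (c , t) = if does (b ≟ᶠ c) then B₂₂ s t else 0ℤ
    entry : ∀ k l → Q (4 ↑ʳ k) (4 ↑ʳ l) ≡ blockDiagonal (remQuot 2 k) (remQuot 2 l)
    entry k l with quotRem {m} 2 k | quotRem {m} 2 l
    ... | s , b | t , c with b ≟ᶠ c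
    ...   | yes _ = refl
    ...   | no  _ = refl

  quadForm-Qmat : ∀ x (ξ : Fin m → Vector ℤ 2) →
    quadForm Q (x ++ concat ξ) ≡ quadForm Q₁₁ x + ∑[ b < m ] (+ 2 * bilinear (A b) (ξ b) x + quadForm B₂₂ (ξ b))
  quadForm-Qmat x ξ = begin
    quadForm Q (x ++ concat ξ)
      ≡⟨ quadForm-bordered Q x ξ ⟩
    _ ≡⟨ cong₂ _+_ (cong₂ _+_ top-left top-right) (cong₂ _+_ bottom-left bottom-right) ⟩
    (quadForm Q₁₁ x + sum β) + (sum β + sum γ)
      ≡⟨ regroup (quadForm Q₁₁ x) (sum β) (sum γ) ⟩
    quadForm Q₁₁ x + (+ 2 * sum β + sum γ)
      ≡⟨ cong (λ e → quadForm Q₁₁ x + (e + sum γ)) (*-distribˡ-sum (+ 2) β) ⟩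
    quadForm Q₁₁ x + (∑[ b < m ] (+ 2 * β b) + sum γ)
      ≡⟨ cong (_+_ (quadForm Q₁₁ x)) (∑-distrib-+ (λ b → + 2 * β b) γ) ⟨
    quadForm Q₁₁ x + ∑[ b < m ] (+ 2 * β b + γ b) ∎
    where
    open ≡-Reasoning
    β γ : Fin m → ℤ
    β b = bilinear (A b) (ξ b) x
    γ b = quadForm B₂₂ (ξ b)

    regroup : ∀ q s t → (q + s) + (s + t) ≡ q + (+ 2 * s + t)
    regroup = solve-∀

    top-left : ∑[ p < 4 ] ∑[ q < 4 ] (x p * Q (p ↑ˡ n) (q ↑ˡ n) * x q) ≡ quadForm Q₁₁ x
    top-left = refl -- for concrete p, q : Fin 4 the index splitting computes

    top-right : ∑[ p < 4 ] ∑[ c < m ] ∑[ t < 2 ] (x p * Q (p ↑ˡ n) (4 ↑ʳ combine c t) * ξ c t) ≡ sum β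
    top-right = trans (sum-cong-≗ λ p → sum-cong-≗ λ c → sum-cong-≗ λ t →
                         cong (λ e → x p * e * ξ c t) (Qmat-↑ˡ-↑ʳ p c t))
                      (trans (∑-comm λ p c → ∑[ t < 2 ] (x p * A c t p * ξ c t))
                             (sum-cong-≗ λ c → bilinear-transpose (A c) (ξ c) x))

    bottom-left : ∑[ b < m ] ∑[ s < 2 ] ∑[ q < 4 ] (ξ b s * Q (4 ↑ʳ combine b s) (q ↑ˡ n) * x q) ≡ sum β
    bottom-left = sum-cong-≗ λ b → sum-cong-≗ λ s → sum-cong-≗ λ q →
                    cong (λ e → ξ b s * e * x q) (Qmat-↑ʳ-↑ˡ b s q)

    bottom-right : ∑[ b < m ] ∑[ s < 2 ] ∑[ c < m ] ∑[ t < 2 ]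
                     (ξ b s * Q (4 ↑ʳ combine b s) (4 ↑ʳ combine c t) * ξ c t) ≡ sum γ
    bottom-right = sum-cong-≗ λ b → sum-cong-≗ λ s → begin
      ∑[ c < m ] ∑[ t < 2 ] (ξ b s * Q (4 ↑ʳ combine b s) (4 ↑ʳ combine c t) * ξ c t)
        ≡⟨ (sum-cong-≗ λ c → trans (sum-cong-≗ λ t →
              trans (cong (λ e → ξ b s * e * ξ c t) (Qmat-↑ʳ-↑ʳ b s c t))
                    (*-if (does (b ≟ᶠ c)) (ξ b s) (B₂₂ s t) (ξ c t)))
            (∑-if (does (b ≟ᶠ c)) λ t → ξ b s * B₂₂ s t * ξ c t)) ⟩
      ∑[ c < m ] (if does (b ≟ᶠ c) then ∑[ t < 2 ] (ξ b s * B₂₂ s t * ξ c t) else 0ℤ)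
        ≡⟨ ∑-δ b (λ c → ∑[ t < 2 ] (ξ b s * B₂₂ s t * ξ c t)) ⟩
      ∑[ t < 2 ] (ξ b s * B₂₂ s t * ξ b t) ∎

-- The Schur complement

-- 9 B₂₂⁻¹ = [[2,1],[1,2]]: schurDirection w = −9 B₂₂⁻¹ w and schurForm w = 9 wᵀ B₂₂⁻¹ w.
schurDirection : Vector ℤ 2 → Vector ℤ 2
schurDirection w 0F = - (+ 2 * w 0F + w 1F)
schurDirection w 1F = - (w 0F + + 2 * w 1F)

schurForm : Vector ℤ 2 → ℤ
schurForm w = + 2 * (w 0F * w 0F) + + 2 * (w 0F * w 1F) + + 2 * (w 1F * w 1F)

schurDirection-identity : ∀ w → let ξ = schurDirection w in
  + 2 * (+ 9 * (ξ ∙ w)) + quadForm B₂₂ ξ ≡ - + 9 * schurForm w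
schurDirection-identity w = trans
  (cong₂ (λ d q → + 2 * (+ 9 * d) + q) (∑₂ λ i → schurDirection w i * w i) (quadForm₂ B₂₂ (schurDirection w)))
  (identity (w 0F) (w 1F))
  where
  identity : ∀ u v → let ξ₀ = - (+ 2 * u + v); ξ₁ = - (u + + 2 * v) in
    + 2 * (+ 9 * (ξ₀ * u + ξ₁ * v))
      + ((ξ₀ * + 6 * ξ₀ + ξ₀ * - + 3 * ξ₁) + (ξ₁ * - + 3 * ξ₀ + ξ₁ * + 6 * ξ₁))
    ≡ - + 9 * (+ 2 * (u * u) + + 2 * (u * v) + + 2 * (v * v))
  identity = solve-∀

gap : Case → Vector ℤ 4 → Mat24 → ℤ
gap X y A = schurForm (entries A *ᵥ y) - quadForm (B X) y

testVector : (a : M → ℕ) → Vector ℤ 4 → Vector ℤ (4 ℕ.+ length (stack a) ℕ.* 2)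
testVector a y = map (+ 9 *_) y ++ concat (λ b → schurDirection (entries (blocks a b) *ᵥ y))

quadForm-testVector : ∀ (Q₁₁ : SqMat 4) a y →
  quadForm (Qmat Q₁₁ a) (testVector a y)
  ≡ + 81 * quadForm Q₁₁ y + ∑[ b < length (stack a) ] (- + 9 * schurForm (entries (blocks a b) *ᵥ y))
quadForm-testVector Q₁₁ a y =
  trans (quadForm-Qmat Q₁₁ a (map (+ 9 *_) y) (λ b → schurDirection (entries (blocks a b) *ᵥ y)))
        (cong₂ _+_ (quadForm-scale Q₁₁ (+ 9) y) (sum-cong-≗ λ b → block (entries (blocks a b))))
  where
  block : ∀ A → let ξ = schurDirection (A *ᵥ y) in
          + 2 * bilinear A ξ (map (+ 9 *_) y) + quadForm B₂₂ ξ ≡ - + 9 * schurForm (A *ᵥ y)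
  block A = begin
    + 2 * bilinear A ξ (map (+ 9 *_) y) + quadForm B₂₂ ξ
      ≡⟨ cong (λ e → + 2 * e + quadForm B₂₂ ξ) (bilinear-scaleʳ A (+ 9) ξ y) ⟩
    + 2 * (+ 9 * bilinear A ξ y) + quadForm B₂₂ ξ
      ≡⟨ cong (λ e → + 2 * (+ 9 * e) + quadForm B₂₂ ξ) (bilinear≡∙*ᵥ A ξ y) ⟩
    + 2 * (+ 9 * (ξ ∙ (A *ᵥ y))) + quadForm B₂₂ ξ
      ≡⟨ schurDirection-identity (A *ᵥ y) ⟩
    - + 9 * schurForm (A *ᵥ y) ∎
    where
    open ≡-Reasoning
    ξ : Vector ℤ 2
    ξ = schurDirection (A *ᵥ y)

length-stack : ∀ a → length (stack a) ≡ total a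
length-stack a = go allM
  where
  go : ∀ L → length (concatMap (λ A → replicate (a A) (proj₁ A)) L) ≡ sumℕ (List.map a L)
  go []      = refl
  go (A ∷ L) = trans (length-++ (replicate (a A) (proj₁ A))) (cong₂ ℕ._+_ (length-replicate (a A)) (go L))

∑gap≤0 : ∀ {a} X → PSD _ (Qmat (B X) a) → total a ≡ 9 →
         ∀ y → ∑[ b < length (stack a) ] gap X y (blocks a b) ≤ 0ℤ
∑gap≤0 {a} X psd total≡9 y = ℤ.*-cancelˡ-≤-neg (- + 9) 0ℤ _ (begin
  0ℤ                                          ≤⟨ PSD⇒0≤quadForm {Q = Qmat (B X) a} psd (testVector a y) ⟩
  quadForm (Qmat (B X) a) (testVector a y)    ≡⟨ quadForm-testVector (B X) a y ⟩
  + 81 * c + ∑[ b < m ] (- + 9 * f b)         ≡⟨ cong (_+_ (+ 81 * c)) (*-distribˡ-sum (- + 9) f) ⟨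
  + 81 * c + - + 9 * sum f                    ≡⟨ regroup c (sum f) ⟩
  - + 9 * (sum f + + 9 * - c)                 ≡⟨ cong (λ k → - + 9 * (sum f + + k * - c)) total≡9 ⟨
  - + 9 * (sum f + + total a * - c)           ≡⟨ cong (λ k → - + 9 * (sum f + + k * - c)) (length-stack a) ⟨
  - + 9 * (sum f + + m * - c)                 ≡⟨ cong (λ e → - + 9 * (sum f + e)) (∑-const m (- c)) ⟨
  - + 9 * (sum f + ∑[ b < m ] (- c))          ≡⟨ cong (- + 9 *_) (∑-distrib-+ f (λ _ → - c)) ⟨
  - + 9 * ∑[ b < m ] gap X y (blocks a b)     ∎)
  where
  open ℤ.≤-Reasoning
  m : ℕ
  m = length (stack a)
  c : ℤ
  c = quadForm (B X) y
  f : Vector ℤ m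
  f b = schurForm (entries (blocks a b) *ᵥ y)
  regroup : ∀ c s → + 81 * c + - + 9 * s ≡ - + 9 * (s + + 9 * - c)
  regroup = solve-∀

==ℤ-sound : ∀ x y → T (x ==ℤ y) → x ≡ y
==ℤ-sound (+ m)    (+ n)    eq = cong +_ (≡ᵇ⇒≡ m n eq)
==ℤ-sound -[1+ m ] -[1+ n ] eq = cong -[1+_] (≡ᵇ⇒≡ m n eq)

∈ᵇ-sound : ∀ x S → T (x ∈ᵇ S) → x ∈ S
∈ᵇ-sound x S = Any.map (==ℤ-sound x _) ∘ any⁻ (x ==ℤ_) S

∈-candidates : ∀ {Z Y} {a b c d e f g h} →
  a ∈ Z → b ∈ Z → c ∈ Y → d ∈ Y → e ∈ Z → f ∈ Z → g ∈ Y → h ∈ Y →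
  ((a ∷ b ∷ c ∷ d ∷ []) ∷ (e ∷ f ∷ g ∷ h ∷ []) ∷ []) ∈ candidates Z Y
∈-candidates a∈ b∈ c∈ d∈ e∈ f∈ g∈ h∈ =
  step a∈ (step b∈ (step c∈ (step d∈ (step e∈ (step f∈ (step g∈ (∈-map⁺ _ h∈)))))))
  where
  step : ∀ {A B : Set} {F : A → List B} {x xs y} → x ∈ xs → y ∈ F x → y ∈ concatMap F xs
  step {F = F} x∈ y∈ = ∈-concatMap⁺ F (Any.map (λ { refl → y∈ }) x∈)

∧-split : ∀ x {y} → T (x ∧ y) → T x × T y
∧-split x = Equivalence.to (T-∧ {x})

inM222ᵇ⇒∈candidates : ∀ Z Y {A} → T (inM222ᵇ Z Y A) → A ∈ candidates Z Y
inM222ᵇ⇒∈candidates Z Y {(a ∷ b ∷ c ∷ d ∷ []) ∷ (e ∷ f ∷ g ∷ h ∷ []) ∷ []} p₀ =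
  let a∈ , p₁ = ∧-split (a ∈ᵇ Z) p₀
      b∈ , p₂ = ∧-split (b ∈ᵇ Z) p₁
      c∈ , p₃ = ∧-split (c ∈ᵇ Y) p₂
      d∈ , p₄ = ∧-split (d ∈ᵇ Y) p₃
      e∈ , p₅ = ∧-split (e ∈ᵇ Z) p₄
      f∈ , p₆ = ∧-split (f ∈ᵇ Z) p₅
      g∈ , h∈ = ∧-split (g ∈ᵇ Y) p₆
  in ∈-candidates (∈ᵇ-sound a Z a∈) (∈ᵇ-sound b Z b∈) (∈ᵇ-sound c Y c∈) (∈ᵇ-sound d Y d∈)
                  (∈ᵇ-sound e Z e∈) (∈ᵇ-sound f Z f∈) (∈ᵇ-sound g Y g∈) (∈ᵇ-sound h Y h∈)

check-just : ∀ Z Y A (p : T (inM222ᵇ Z Y A)) → check Z Y A ≡ just (A , p)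
check-just Z Y A p with T? (inM222ᵇ Z Y A)
... | yes q  = cong (λ q → just (A , q)) (T-irrelevant q p)
... | no  ¬p = ⊥-elim (¬p p)

allM222-complete : ∀ Z Y (A : M222 Z Y) → A ∈ allM222 Z Y
allM222-complete Z Y (A , p) = mapMaybe⁺ (check Z Y) (candidates Z Y)
  (Any-map⁺ (Any.map (λ { refl → subst (Maybe.Any ((A , p) ≡_)) (sym (check-just Z Y A p)) (Maybe.just refl) })
                     (inM222ᵇ⇒∈candidates Z Y p)))

allM-complete : ∀ (A : M) → A ∈ allM
allM-complete = allM222-complete Z₀ Y₀

blocks∈M : ∀ {P : Mat24 → Set} a → (∀ (A : M) → P (proj₁ A)) → ∀ b → P (blocks a b)
blocks∈M {P} a p b = All.lookup P-stack (∈-fromList⁻ {xs = stack a} (∈-lookup b (Vec.fromList (stack a))))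
  where
  P-stack : All P (stack a)
  P-stack = concat⁺ (map⁺ {xs = allM} {f = λ A → replicate (a A) (proj₁ A)}
                          (All.tabulate λ {A} _ → replicate⁺ (a A) (p A)))

∈-replicate : ∀ {A : Set} n (x : A) → n ≢ 0 → x ∈ replicate n x
∈-replicate zero    x n≢0 = ⊥-elim (n≢0 refl)
∈-replicate (suc n) x n≢0 = here refl

weight≢0⇒block : ∀ a (A : M) → a A ≢ 0 → ∃ λ b → blocks a b ≡ proj₁ A
weight≢0⇒block a A aA≢0 = VecAny.index A∈ , sym (lookup-index A∈)
  where
  A∈stack : proj₁ A ∈ stack a
  A∈stack = ∈-concatMap⁺ (λ B → replicate (a B) (proj₁ B))
    (Any.map (λ { refl → ∈-replicate (a A) (proj₁ A) aA≢0 }) (allM-complete A))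
  A∈ : VecAny.Any (proj₁ A ≡_) (Vec.fromList (stack a))
  A∈ = ∈-fromList⁺ A∈stack

-- Certificates, checked by evaluation

testVectors : Case → List (Vector ℤ 4)
testVectors I  = List.map fromVec
  ( (-1ℤ ∷ -1ℤ ∷ 0ℤ ∷ 1ℤ ∷ []) ∷ (-1ℤ ∷ 0ℤ ∷ -1ℤ ∷ 0ℤ ∷ []) ∷ (0ℤ ∷ -1ℤ ∷ 1ℤ ∷ 1ℤ ∷ [])
  ∷ (0ℤ ∷ 0ℤ ∷ -1ℤ ∷ -1ℤ ∷ []) ∷ (0ℤ ∷ 0ℤ ∷ -1ℤ ∷ 0ℤ ∷ []) ∷ [])
testVectors II = List.map fromVec
  ( (-1ℤ ∷ 0ℤ ∷ -1ℤ ∷ 0ℤ ∷ []) ∷ (0ℤ ∷ -1ℤ ∷ 1ℤ ∷ 1ℤ ∷ []) ∷ (0ℤ ∷ 0ℤ ∷ -1ℤ ∷ -1ℤ ∷ [])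
  ∷ (0ℤ ∷ 0ℤ ∷ -1ℤ ∷ 0ℤ ∷ []) ∷ (0ℤ ∷ 0ℤ ∷ 0ℤ ∷ -1ℤ ∷ []) ∷ [])

0≤gap : ∀ X → All (λ y → All (λ A → 0ℤ ≤ gap X y (proj₁ A)) allM) (testVectors X)
0≤gap I  = toWitness {a? = all? (λ y → all? (λ A → 0ℤ ≤? gap I y (proj₁ A)) allM) (testVectors I)} _
0≤gap II = toWitness {a? = all? (λ y → all? (λ A → 0ℤ ≤? gap II y (proj₁ A)) allM) (testVectors II)} _

in-MX-or-separated? : ∀ X (A : M) →
  Dec (proj₁ A ∈ MX X ⊎ Any (λ y → 0ℤ < gap X y (proj₁ A)) (testVectors X))
in-MX-or-separated? X A =
  (proj₁ A ∈? MX X) ⊎-dec any? (λ y → 0ℤ <? gap X y (proj₁ A)) (testVectors X)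
  where open DecMembership (≡-dec (≡-dec ℤ._≟_))

in-MX-or-separated : ∀ X →
  All (λ A → proj₁ A ∈ MX X ⊎ Any (λ y → 0ℤ < gap X y (proj₁ A)) (testVectors X)) allM
in-MX-or-separated I  = toWitness {a? = all? (in-MX-or-separated? I) allM} _
in-MX-or-separated II = toWitness {a? = all? (in-MX-or-separated? II) allM} _

separating-vector : ∀ X (A : M) → ¬ (proj₁ A ∈ MX X) →
  ∃ λ y → (∀ (A′ : M) → 0ℤ ≤ gap X y (proj₁ A′)) × 0ℤ < gap X y (proj₁ A)
separating-vector X A A∉MX =
  y , All.lookup (proj₁ 0≤gap∩0<gap) ∘ allM-complete , proj₂ 0≤gap∩0<gap
  where
  separated : Any (λ y → 0ℤ < gap X y (proj₁ A)) (testVectors X)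
  separated = [ ⊥-elim ∘ A∉MX , id ]′ (All.lookup (in-MX-or-separated X) (allM-complete A))
  y : Vector ℤ 4
  y = Any.lookup separated
  0≤gap∩0<gap : All (λ A′ → 0ℤ ≤ gap X y (proj₁ A′)) allM × 0ℤ < gap X y (proj₁ A)
  0≤gap∩0<gap = lookupAny (0≤gap X) separated

lemma4p8 : (a : M → ℕ) (X : Case) →
    PSD _ (Qmat (B X) a) → total a ≡ 9 →
    (A : M) → ¬ (proj₁ A ∈ MX X) → a A ≡ 0
lemma4p8 a X psd total≡9 A A∉MX = decidable-stable (a A ℕ.≟ 0) λ aA≢0 →
  let y , 0≤gap-M , 0<gap = separating-vector X A A∉MX
      b , bA = weight≢0⇒block a A aA≢0
  in ℤ.<-irrefl refl (begin-strict
    0ℤ                                             <⟨ 0<gap ⟩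
    gap X y (proj₁ A)                              ≡⟨ cong (gap X y) bA ⟨
    gap X y (blocks a b)                           ≤⟨ ≤-∑ (blocks∈M {λ A → 0ℤ ≤ gap X y A} a 0≤gap-M) b ⟩
    ∑[ b < length (stack a) ] gap X y (blocks a b) ≤⟨ ∑gap≤0 {a} X psd total≡9 y ⟩
    0ℤ                                             ∎)
  where open ℤ.≤-Reasoning
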